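{- The map $f\mapsto(\pi(f),\lambda(f))$ is a bijection between $\mathbb N_0^{(r,n)}$ and $G(r,n)\times\mathcal P_n$. Moreover, if $\gamma=\pi(f)$ and $\lambda=\lambda(f)$, then $\max(f)=\max(\lambda)+\mathrm{des}_G(\gamma)$ and $|f|=|\lambda|+n\,\mathrm{des}_G(\gamma)-\mathrm{maj}(\gamma)$.
   Context: $G(r,n)$ is the set of $r$-colored permutations $\gamma=(c_1,\dots,c_n;\sigma)$, $c_i\in\{0,\dots,r-1\}$, $\sigma\in S_n$, written $\gamma=[\gamma(1),\dots,\gamma(n)]=[\sigma(1)^{c_1},\dots,\sigma(n)^{c_n}]$. Colored integers $x^c$ ($x^0=x$) are totally ordered by: uncolored integers in natural order; every $x^c$ with $c\ge1$ is smaller than every uncolored integer (including $0$); for $c,d\ge1$, $x^c<y^d$ iff $x>y$, or $x=y$ and $c>d$. $\mathrm{Des}_G(\gamma)=\{i\in\{0,\dots,n-1\}:\gamma(i)>\gamma(i+1)\}$ with $\gamma(0):=0$; $\mathrm{des}_G=|\mathrm{Des}_G|$; $\mathrm{maj}(\gamma)=\sum_{i\in\mathrm{Des}_G(\gamma)}i$. $\mathcal P_n$ is the set of nondecreasing sequences $(\lambda_1,\dots,\lambda_n)$ of nonnegative integers; $\max(\lambda)=\lambda_n$ (or $0$), $|\lambda|=\sum\lambda_i$. $\mathbb N_0^{(r,n)}$ is the set of $n$-tuples $f=(f_1^{c_1},\dots,f_n^{c_n})$ with $f_i\in\mathbb N$, $c_i\in\{0,\dots,r-1\}$, $c_i=0$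 whenever $f_i=0$; $\max(f)=\max_if_i$, $|f|=\sum_if_i$. For such $f$ and $\nu\in\mathbb N$ let $A_\nu=\{i^{c_i}:f_i=\nu\}$; arranging each nonempty $A_\nu$ increasingly and juxtaposing blocks in order of increasing $\nu$ gives the window notation of $\pi(f)\in G(r,n)$. Writing $\pi(f)=(c'_1,\dots,c'_n;\sigma)$, $\lambda(f)=(\lambda_1,\dots,\lambda_n)$ with $\lambda_i=f_{\sigma(i)}-|\{j\in\mathrm{Des}_G(\pi(f)):j\le i-1\}|$. -}

module Defs where

open import Data.Nat as ℕ using (ℕ; zero; suc; _⊔_)
open import Data.Integer as ℤ using (ℤ; +_)
open import Data.Bool using (Bool; true; false; if_then_else_; _∧_; _∨_)
open import Data.Fin as Fin using (Fin; toℕ)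
open import Data.Product using (_×_; _,_; proj₁; proj₂)
open import Data.List as List using (List; []; _∷_)
open import Data.Nat.ListAction using (sum)
open import Data.Vec as Vec using (Vec; []; _∷_; lookup; tabulate)
open import Relation.Binary.PropositionalEquality using (_≡_)

-- Colored integers x^c, represented as pairs (x , c) of naturals;
-- c = 0 means "uncolored".

CInt : Set
CInt = ℕ × ℕ

_<ᶜ_ : CInt → CInt → Bool
(x , zero)  <ᶜ (y , zero)  = x ℕ.<ᵇ y
(x , suc _) <ᶜ (y , zero)  = true
(x , zero)  <ᶜ (y , suc _) = false
(x , suc c) <ᶜ (y , suc d) = (y ℕ.<ᵇ x) ∨ ((x ℕ.≡ᵇ y) ∧ (d ℕ.<ᵇ c))

-- G(r,n): an r-colored permutation γ = [σ(1)^{c_1}, …, σ(n)^{c_n}] is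
-- given in window notation as a vector of pairs (σ(i) , c_i), where the
-- value σ(i) ∈ {1,…,n} is encoded by an element of Fin n (k ↦ toℕ k + 1).

Window : ℕ → ℕ → Set
Window r n = Vec (Fin n × Fin r) n

IsColoredPerm : ∀ {r n} → Window r n → Set
IsColoredPerm {r} {n} w =
  (i j : Fin n) → proj₁ (lookup w i) ≡ proj₁ (lookup w j) → i ≡ j

entry : ∀ {r n} → Fin n × Fin r → CInt
entry (x , c) = (suc (toℕ x) , toℕ c)

desAux : ℕ → List CInt → List ℕ
desAux i (a ∷ b ∷ rest) =
  if b <ᶜ a then i ∷ desAux (suc i) (b ∷ rest) else desAux (suc i) (b ∷ rest)
desAux i _ = []

-- Des_G(γ) = { i ∈ {0,…,n-1} : γ(i) > γ(i+1) },  γ(0) := 0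
Des : ∀ {r n} → Window r n → List ℕ
Des w = desAux 0 ((0 , 0) ∷ List.map entry (Vec.toList w))

des : ∀ {r n} → Window r n → ℕ
des w = List.length (Des w)

maj : ∀ {r n} → Window r n → ℕ
maj w = sum (Des w)

-- ℕ₀^{(r,n)}: tuples f = (f_1^{c_1}, …, f_n^{c_n}), stored as pairs
-- (f_i , c_i), with c_i = 0 whenever f_i = 0.

CTuple : ℕ → ℕ → Set
CTuple r n = Vec (ℕ × Fin r) n

InN0 : ∀ {r n} → CTuple r n → Set
InN0 {r} {n} f = (i : Fin n) → proj₁ (lookup f i) ≡ 0 → toℕ (proj₂ (lookup f i)) ≡ 0

maxF : ∀ {r n} → CTuple r n → ℕ
maxF f = Vec.foldr _ (λ p m → proj₁ p ⊔ m) 0 f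

sumF : ∀ {r n} → CTuple r n → ℕ
sumF f = Vec.foldr _ (λ p s → proj₁ p ℕ.+ s) 0 f

-- π(f): sort the entries (f_i , i^{c_i}) by f_i, and inside a block of
-- equal f_i increasingly in the colored order (insertion sort).

Key : ℕ → ℕ → Set
Key r n = ℕ × (Fin n × Fin r)

_≤ᵏ_ : ∀ {r n} → Key r n → Key r n → Bool
(ν , a) ≤ᵏ (μ , b) = (ν ℕ.<ᵇ μ) ∨ ((ν ℕ.≡ᵇ μ) ∧ (entry a <ᶜ entry b))

insert : ∀ {r n m} → Key r n → Vec (Key r n) m → Vec (Key r n) (suc m)
insert k [] = k ∷ []
insert k (x ∷ xs) = if k ≤ᵏ x then k ∷ x ∷ xs else x ∷ insert k xs

isort : ∀ {r n m} → Vec (Key r n) m → Vec (Key r n) m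
isort [] = []
isort (x ∷ xs) = insert x (isort xs)

keys : ∀ {r n} → CTuple r n → Vec (Key r n) n
keys f = tabulate (λ i → (proj₁ (lookup f i) , (i , proj₂ (lookup f i))))

π : ∀ {r n} → CTuple r n → Window r n
π f = Vec.map proj₂ (isort (keys f))

-- λ(f) (as integers): for k ∈ {1,…,n} (encoded as Fin n, k = toℕ i + 1)
-- λ_k = f_{σ(k)} − |{ j ∈ Des_G(π(f)) : j ≤ k − 1 }|.

countLe : ℕ → List ℕ → ℕ
countLe k ds = List.length (List.filter (λ j → j ℕ.≤? k) ds)

lam : ∀ {r n} → CTuple r n → Vec ℤ n
lam f = tabulate (λ i →
  + proj₁ (lookup f (proj₁ (lookup (π f) i))) ℤ.- + countLe (toℕ i) (Des (π f)))

-- 𝒫_n: nondecreasing sequences of nonnegative integers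
-- (stored as integer vectors whose entries are all ≥ 0).

InP : ∀ {n} → Vec ℤ n → Set
InP {n} l = ((i : Fin n) → + 0 ℤ.≤ lookup l i)
          × ((i j : Fin n) → i Fin.≤ j → lookup l i ℤ.≤ lookup l j)

-- max(λ) = λ_n (or 0 if n = 0)
maxP : ∀ {n} → Vec ℤ n → ℤ
maxP [] = + 0
maxP (x ∷ []) = x
maxP (x ∷ y ∷ xs) = maxP (y ∷ xs)

sumP : ∀ {n} → Vec ℤ n → ℤ
sumP l = Vec.foldr _ ℤ._+_ (+ 0) l

-- Sorting the entries (f_i, i^{c_i}) of f by value and then by the colored order lists keys
-- (v_1, γ(1)), …, (v_n, γ(n)) with γ = π(f), and λ_k = v_k − d_k where d_k counts the descents
-- of γ at positions 0, …, k − 1.  Keys with distinct indices arise from some f exactly when,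
-- with the pseudo-key (0, γ(0) = 0) in front, each consecutive pair satisfies
-- v + [descent between them] ≤ v′; as d grows by exactly that indicator, this says that λ is a
-- nondecreasing sequence of nonnegative integers, and v_k = λ_k + d_k inverts f ↦ (γ, λ).
-- Summing gives the statistics: d_n = des(γ) and Σ_k d_k = n·des(γ) − maj(γ).
module Submission where

open import Defs
open import Data.Nat using (ℕ; _*_)
open import Data.Integer using (+_; _+_; _-_)
open import Data.Vec using (Vec)
open import Data.Integer using (ℤ)
open import Data.Product using (_×_; ∃)
open import Relation.Binary.PropositionalEquality using (_≡_)

open import Algebra.Definitions using (Associative; Commutative)
open import Data.Bool using (Bool; true; false; if_then_else_)
open import Data.Empty using (⊥)
open import Data.Fin as Fin using (Fin; toℕ)
import Data.Fin.Properties as Fin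
open import Data.Integer as ℤ using ()
import Data.Integer.Properties as ℤ
import Data.Integer.Tactic.RingSolver as ℤ-Solver
open import Data.List as List using (List)
import Data.List.Properties as List
open import Data.Nat as ℕ using (zero; suc; _<_; _≤_; z≤n; s≤s)
open import Data.Nat.ListAction using (sum)
import Data.Nat.Properties as ℕ
import Data.Nat.Tactic.RingSolver as ℕ-Solver
open import Data.Product using (_,_; proj₁; proj₂)
open import Data.Product.Relation.Binary.Lex.Strict using (×-Lex; ×-isStrictTotalOrder)
open import Data.Product.Relation.Binary.Pointwise.NonDependent using (Pointwise)
open import Data.Sum using (_⊎_; inj₁; inj₂; [_,_])
open import Data.Unit using (⊤; tt)
open import Data.Vec as Vec using ([]; _∷_; lookup; tabulate)
import Data.Vec.Properties as Vec
open import Data.Vec.Membership.Propositional using (_∈_)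
open import Data.Vec.Membership.Propositional.Properties using (∈-lookup)
open import Data.Vec.Relation.Unary.All as All using (All; []; _∷_)
import Data.Vec.Relation.Unary.All.Properties as AllP
open import Data.Vec.Relation.Unary.AllPairs using (AllPairs; []; _∷_)
import Data.Vec.Relation.Unary.AllPairs.Properties as AllPairsP
open import Data.Vec.Relation.Unary.Any as Any using (here; there)
import Data.Vec.Relation.Unary.Any.Properties as AnyP
open import Data.Vec.Relation.Unary.Linked as Linked using (Linked; []; [-]; _∷_)
open import Data.Vec.Relation.Unary.Linked.Properties using (Linked⇒All; lookup⁺)
import Data.Vec.Relation.Unary.Unique.Propositional.Properties as Unique
open import Function using (_∘_; _on_)
open import Level using (0ℓ)
import Relation.Binary.Construct.On as On
open import Relation.Binary.Core using (Rel)
open import Relation.Binary.Definitions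
  using (Transitive; Symmetric; Asymmetric; Trichotomous; tri<; tri≈; tri>)
open import Relation.Binary.PropositionalEquality as ≡ using (refl; cong; _≢_)
open import Relation.Binary.Structures using (IsStrictTotalOrder)
open import Relation.Binary.Structures.Biased using (isStrictTotalOrderᶜ)
open import Relation.Nullary.Decidable using (yes; no)
open import Relation.Nullary.Negation using (¬_; contradiction)
open import Relation.Nullary.Reflects using (Reflects; ofʸ; ofⁿ; fromEquivalence; _⊎-reflects_; _×-reflects_)

lastOr : ∀ {A : Set} {m} → A → Vec A m → A
lastOr d []       = d
lastOr d (x ∷ xs) = lastOr x xs

lastOr-zipWith : ∀ {A B C : Set} (f : A → B → C) {m} a b (xs : Vec A m) (ys : Vec B m) →
                 lastOr (f a b) (Vec.zipWith f xs ys) ≡ f (lastOr a xs) (lastOr b ys)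
lastOr-zipWith f a b []       []       = refl
lastOr-zipWith f a b (x ∷ xs) (y ∷ ys) = lastOr-zipWith f x y xs ys

⊔-foldr-nondecreasing : ∀ {m} d (vs : Vec ℕ m) → Linked _≤_ (d ∷ vs) →
                        d ℕ.⊔ Vec.foldr _ ℕ._⊔_ 0 vs ≡ lastOr d vs
⊔-foldr-nondecreasing d []       _             = ℕ.⊔-identityʳ d
⊔-foldr-nondecreasing d (v ∷ vs) (d≤v ∷ v∷vs↑) = begin
  d ℕ.⊔ (v ℕ.⊔ rest) ≡⟨ ℕ.⊔-assoc d v rest ⟨
  (d ℕ.⊔ v) ℕ.⊔ rest ≡⟨ cong (ℕ._⊔ rest) (ℕ.m≤n⇒m⊔n≡n d≤v) ⟩
  v ℕ.⊔ rest         ≡⟨ ⊔-foldr-nondecreasing v vs v∷vs↑ ⟩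
  lastOr v vs        ∎
  where
  open ≡.≡-Reasoning
  rest = Vec.foldr _ ℕ._⊔_ 0 vs

monotone⇒Linked : ∀ {A : Set} {R : Rel A 0ℓ} {m} {xs : Vec A m} →
                  (∀ i j → i Fin.≤ j → R (lookup xs i) (lookup xs j)) → Linked R xs
monotone⇒Linked {xs = []}         _    = []
monotone⇒Linked {xs = x ∷ []}     _    = [-]
monotone⇒Linked {xs = x ∷ y ∷ xs} mono =
  mono Fin.zero (Fin.suc Fin.zero) z≤n ∷ monotone⇒Linked (λ i j i≤j → mono (Fin.suc i) (Fin.suc j) (s≤s i≤j))

lookup-ext : ∀ {A : Set} {m} {xs ys : Vec A m} → (∀ i → lookup xs i ≡ lookup ys i) → xs ≡ ys
lookup-ext {xs = xs} {ys} xsᵢ≡ysᵢ = begin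
  xs                ≡⟨ Vec.tabulate∘lookup xs ⟨
  tabulate (lookup xs) ≡⟨ Vec.tabulate-cong xsᵢ≡ysᵢ ⟩
  tabulate (lookup ys) ≡⟨ Vec.tabulate∘lookup ys ⟩
  ys                ∎
  where open ≡.≡-Reasoning

map-proj₁-proj₂-injective : ∀ {A B : Set} {m} {xs ys : Vec (A × B) m} →
                            Vec.map proj₁ xs ≡ Vec.map proj₁ ys → Vec.map proj₂ xs ≡ Vec.map proj₂ ys →
                            xs ≡ ys
map-proj₁-proj₂-injective {xs = []}     {[]}     _  _  = refl
map-proj₁-proj₂-injective {xs = _ ∷ _} {_ ∷ _} e₁ e₂ =
  ≡.cong₂ _∷_ (≡.cong₂ _,_ (Vec.∷-injectiveˡ e₁) (Vec.∷-injectiveˡ e₂))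
              (map-proj₁-proj₂-injective (Vec.∷-injectiveʳ e₁) (Vec.∷-injectiveʳ e₂))

module _ {A B : Set} {g : A → B} where

  AllPairs-≢-on⇒injective : ∀ {m} {xs : Vec A m} → AllPairs (_≢_ on g) xs →
                            ∀ i j → g (lookup xs i) ≡ g (lookup xs j) → i ≡ j
  AllPairs-≢-on⇒injective {xs = xs} ≢xs i j eq = Unique.lookup-injective (AllPairsP.map⁺ ≢xs) i j
    (≡.trans (Vec.lookup-map i g xs) (≡.trans eq (≡.sym (Vec.lookup-map j g xs))))

  injective⇒AllPairs-≢-on : ∀ {m} {xs : Vec A m} → (∀ i j → g (lookup xs i) ≡ g (lookup xs j) → i ≡ j) →
                            AllPairs (_≢_ on g) xs
  injective⇒AllPairs-≢-on {xs = xs} inj =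
    ≡.subst (AllPairs _) (Vec.tabulate∘lookup xs) (AllPairsP.tabulate⁺ λ i≢j → i≢j ∘ inj _ _)

-- If j is missed, punching j out of the range maps Fin (1 + m) injectively into Fin m.
injective⇒surjective : ∀ {m} (σ : Fin m → Fin m) → (∀ i j → σ i ≡ σ j → i ≡ j) →
                       ∀ j → ∃ λ i → σ i ≡ j
injective⇒surjective {suc m} σ σ-inj j with Fin.any? (λ i → σ i Fin.≟ j)
... | yes σi≡j = σi≡j
... | no  σ≢j  with Fin.pigeonhole (ℕ.n<1+n m) (λ i → Fin.punchOut (σ≢j ∘ (i ,_) ∘ ≡.sym))
...   | i , i′ , i<i′ , eq =
  contradiction (σ-inj i i′ (Fin.punchOut-injective (σ≢j ∘ (i ,_) ∘ ≡.sym) (σ≢j ∘ (i′ ,_) ∘ ≡.sym) eq))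
    (Fin.<⇒≢ i<i′)

foldr-proj₁ : ∀ {A : Set} (_∙_ : ℕ → ℕ → ℕ) e {m} (xs : Vec (ℕ × A) m) →
              Vec.foldr _ (λ p acc → proj₁ p ∙ acc) e xs ≡ Vec.foldr _ _∙_ e (Vec.map proj₁ xs)
foldr-proj₁ _∙_ e []       = refl
foldr-proj₁ _∙_ e (x ∷ xs) = cong (proj₁ x ∙_) (foldr-proj₁ _∙_ e xs)

module _ {A : Set} {_≺_ : Rel A 0ℓ} (asym : Asymmetric _≺_) where

  AllPairs-unique : ∀ {m} {xs ys : Vec A m} → AllPairs _≺_ xs → AllPairs _≺_ ys →
                    (∀ {z} → z ∈ xs → z ∈ ys) → (∀ {z} → z ∈ ys → z ∈ xs) → xs ≡ ys
  AllPairs-unique {xs = []} {[]} _ _ _ _ = refl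
  AllPairs-unique {xs = x ∷ xs} {y ∷ ys} (x≺xs ∷ sxs) (y≺ys ∷ sys) xs⊆ys ys⊆xs =
    ≡.cong₂ _∷_ x≡y (AllPairs-unique sxs sys xs′⊆ys′ ys′⊆xs′)
    where
    irrefl : ∀ {z} → ¬ z ≺ z
    irrefl z≺z = asym z≺z z≺z
    x≡y : x ≡ y
    x≡y with xs⊆ys (here refl) | ys⊆xs (here refl)
    ... | here x≡y   | _          = x≡y
    ... | there _    | here y≡x   = ≡.sym y≡x
    ... | there x∈ys | there y∈xs = contradiction (All.lookup y≺ys x∈ys) (asym (All.lookup x≺xs y∈xs))
    xs′⊆ys′ : ∀ {z} → z ∈ xs → z ∈ ys
    xs′⊆ys′ z∈xs with xs⊆ys (there z∈xs)
    ... | here refl = contradiction (≡.subst (_≺ _) x≡y (All.lookup x≺xs z∈xs)) irrefl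
    ... | there z∈ys = z∈ys
    ys′⊆xs′ : ∀ {z} → z ∈ ys → z ∈ xs
    ys′⊆xs′ z∈ys with ys⊆xs (there z∈ys)
    ... | here refl = contradiction (≡.subst (_ ≺_) x≡y (All.lookup y≺ys z∈ys)) irrefl
    ... | there z∈xs = z∈xs

infix 7 _⊝_
_⊝_ : ℕ → ℕ → ℤ
v ⊝ d = + v - + d

i-j+j≡i : ∀ i j → i - j + j ≡ i
i-j+j≡i = ℤ-Solver.solve-∀

⊝-+-cancelʳ : ∀ v c d → (v ℕ.+ d) ⊝ (c ℕ.+ d) ≡ v ⊝ c
⊝-+-cancelʳ v c d = begin
  + (v ℕ.+ d) - + (c ℕ.+ d)     ≡⟨ ≡.cong₂ _-_ (ℤ.pos-+ v d) (ℤ.pos-+ c d) ⟩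
  (+ v + + d) - (+ c + + d) ≡⟨ cancel (+ v) (+ c) (+ d) ⟩
  + v - + c                     ∎
  where
  open ≡.≡-Reasoning
  cancel : ∀ i j k → (i + k) - (j + k) ≡ i - j
  cancel = ℤ-Solver.solve-∀

⊝-mono : ∀ {u v} c β → u ℕ.+ β ≤ v → u ⊝ c ℤ.≤ v ⊝ (c ℕ.+ β)
⊝-mono {u} {v} c β u+β≤v = begin
  u ⊝ c                   ≡⟨ ⊝-+-cancelʳ u c β ⟨
  (u ℕ.+ β) ⊝ (c ℕ.+ β)   ≤⟨ ℤ.+-monoˡ-≤ (ℤ.- + (c ℕ.+ β)) (ℤ.+≤+ u+β≤v) ⟩
  v ⊝ (c ℕ.+ β)           ∎
  where open ℤ.≤-Reasoning

sumP-zipWith-⊝ : ∀ {m} (vs ds : Vec ℕ m) → sumP (Vec.zipWith _⊝_ vs ds) ≡ + Vec.sum vs - + Vec.sum ds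
sumP-zipWith-⊝ []       []       = refl
sumP-zipWith-⊝ (v ∷ vs) (d ∷ ds) = begin
  v ⊝ d + sumP (Vec.zipWith _⊝_ vs ds)         ≡⟨ cong (λ s → v ⊝ d + s) (sumP-zipWith-⊝ vs ds) ⟩
  (+ v - + d) + (+ Vec.sum vs - + Vec.sum ds)  ≡⟨ interchange (+ v) (+ d) (+ Vec.sum vs) (+ Vec.sum ds) ⟩
  (+ v + + Vec.sum vs) - (+ d + + Vec.sum ds) ≡⟨ ≡.cong₂ _-_ (ℤ.pos-+ v _) (ℤ.pos-+ d _) ⟨
  (v ℕ.+ Vec.sum vs) ⊝ (d ℕ.+ Vec.sum ds)        ∎
  where
  open ≡.≡-Reasoning
  interchange : ∀ a b c d → (a - b) + (c - d) ≡ (a + c) - (b + d)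
  interchange = ℤ-Solver.solve-∀

zipWith-⊝-cancelʳ : ∀ {m} (xs ys ds : Vec ℕ m) → Vec.zipWith _⊝_ xs ds ≡ Vec.zipWith _⊝_ ys ds → xs ≡ ys
zipWith-⊝-cancelʳ []       []       []       _  = refl
zipWith-⊝-cancelʳ (x ∷ xs) (y ∷ ys) (d ∷ ds) eq =
  ≡.cong₂ _∷_ (ℤ.+-injective (begin
    + x               ≡⟨ i-j+j≡i (+ x) (+ d) ⟨
    x ⊝ d + + d     ≡⟨ cong (_+ + d) (Vec.∷-injectiveˡ eq) ⟩
    y ⊝ d + + d     ≡⟨ i-j+j≡i (+ y) (+ d) ⟩
    + y               ∎))
  (zipWith-⊝-cancelʳ xs ys ds (Vec.∷-injectiveʳ eq))
  where open ≡.≡-Reasoning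

zipWith-⊝-lift : ∀ {m} (zs : Vec ℤ m) ds → All (+ 0 ℤ.≤_) zs →
                 Vec.zipWith _⊝_ (Vec.zipWith (λ z d → ℤ.∣ z ∣ ℕ.+ d) zs ds) ds ≡ zs
zipWith-⊝-lift []       []       []         = refl
zipWith-⊝-lift (z ∷ zs) (d ∷ ds) (0≤z ∷ 0≤zs) =
  ≡.cong₂ _∷_ (≡.trans (⊝-+-cancelʳ ℤ.∣ z ∣ 0 d) (≡.trans (ℤ.+-identityʳ _) (ℤ.0≤i⇒+∣i∣≡i 0≤z)))
              (zipWith-⊝-lift zs ds 0≤zs)

maxP≡lastOr : ∀ {m} (l : Vec ℤ m) → maxP l ≡ lastOr (+ 0) l
maxP≡lastOr []           = refl
maxP≡lastOr (x ∷ [])     = refl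
maxP≡lastOr (x ∷ y ∷ l)  = maxP≡lastOr (y ∷ l)

InP⇒Linked : ∀ {m} {l : Vec ℤ m} → InP l → Linked ℤ._≤_ (+ 0 ∷ l)
InP⇒Linked {l = []}    _              = [-]
InP⇒Linked {l = x ∷ l} (0≤l , l↑)     = 0≤l Fin.zero ∷ monotone⇒Linked l↑

Linked⇒InP : ∀ {m} {l : Vec ℤ m} → Linked ℤ._≤_ (+ 0 ∷ l) → InP l
Linked⇒InP {l = []}    _          = (λ ()) , (λ ())
Linked⇒InP {l = x ∷ l} (0≤x ∷ l↑) = AllP.lookup⁺ (Linked⇒All ℤ.≤-trans 0≤x l↑) , monotone
  where
  monotone : ∀ i j → i Fin.≤ j → lookup (x ∷ l) i ℤ.≤ lookup (x ∷ l) j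
  monotone i j i≤j with ℕ.m≤n⇒m<n∨m≡n i≤j
  ... | inj₁ i<j = lookup⁺ ℤ.≤-trans l↑ i<j
  ... | inj₂ i≡j rewrite Fin.toℕ-injective i≡j = ℤ.≤-refl

-- The colored order and the order on keys

_⊏_ : Rel CInt 0ℓ
(x , zero)  ⊏ (y , zero)  = x < y
(x , suc _) ⊏ (y , zero)  = ⊤
(x , zero)  ⊏ (y , suc _) = ⊥
(x , suc c) ⊏ (y , suc d) = y < x ⊎ (x ≡ y × d < c)

<ᶜ-reflects-⊏ : ∀ a b → Reflects (a ⊏ b) (a <ᶜ b)
<ᶜ-reflects-⊏ (x , zero)  (y , zero)  = ℕ.<ᵇ-reflects-< x y
<ᶜ-reflects-⊏ (x , suc _) (y , zero)  = ofʸ tt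
<ᶜ-reflects-⊏ (x , zero)  (y , suc _) = ofⁿ λ ()
<ᶜ-reflects-⊏ (x , suc c) (y , suc d) =
  ℕ.<ᵇ-reflects-< y x ⊎-reflects
  (fromEquivalence (ℕ.≡ᵇ⇒≡ x y) (ℕ.≡⇒≡ᵇ x y) ×-reflects ℕ.<ᵇ-reflects-< d c)

⊏-trans : Transitive _⊏_
⊏-trans {x , zero}  {y , zero}  {z , zero}  p q = ℕ.<-trans p q
⊏-trans {x , suc _} {y , zero}  {z , zero}  p q = tt
⊏-trans {x , suc _} {y , suc _} {z , zero}  p q = tt
⊏-trans {x , suc _} {y , suc _} {z , suc _} (inj₁ y<x) (inj₁ z<y) = inj₁ (ℕ.<-trans z<y y<x)
⊏-trans {x , suc _} {y , suc _} {z , suc _} (inj₁ y<x) (inj₂ (refl , _)) = inj₁ y<x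
⊏-trans {x , suc _} {y , suc _} {z , suc _} (inj₂ (refl , _)) (inj₁ z<y) = inj₁ z<y
⊏-trans {x , suc _} {y , suc _} {z , suc _} (inj₂ (refl , d<c)) (inj₂ (refl , e<d)) =
  inj₂ (refl , ℕ.<-trans e<d d<c)
⊏-trans {x , zero}  {y , suc _} ()
⊏-trans {x , _}     {y , zero}  {z , suc _} p ()

⊏-compare : Trichotomous _≡_ _⊏_
⊏-compare (x , zero) (y , zero) with ℕ.<-cmp x y
... | tri< x<y x≢y y≮x = tri< x<y (x≢y ∘ cong proj₁) y≮x
... | tri≈ x≮y refl y≮x = tri≈ x≮y refl y≮x
... | tri> x≮y x≢y y<x = tri> x≮y (x≢y ∘ cong proj₁) y<x
⊏-compare (x , zero)  (y , suc _) = tri> (λ ()) (λ ()) tt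
⊏-compare (x , suc _) (y , zero)  = tri< tt (λ ()) (λ ())
⊏-compare (x , suc c) (y , suc d) with ℕ.<-cmp y x
... | tri< y<x y≢x _ = tri< (inj₁ y<x) (y≢x ∘ ≡.sym ∘ cong proj₁)
                            [ ℕ.<-asym y<x , (λ (e , _) → ℕ.<-irrefl e y<x) ]
... | tri> _ y≢x x<y = tri> [ ℕ.<-asym x<y , (λ (e , _) → ℕ.<-irrefl e x<y) ]
                            (y≢x ∘ ≡.sym ∘ cong proj₁) (inj₁ x<y)
... | tri≈ y≮x refl x≮y with ℕ.<-cmp d c
...   | tri< d<c d≢c _ = tri< (inj₂ (refl , d<c)) (d≢c ∘ ≡.sym ∘ ℕ.suc-injective ∘ cong proj₂)
                              [ x≮y , ℕ.<-asym d<c ∘ proj₂ ]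
...   | tri≈ _ refl _ = tri≈ [ y≮x , ℕ.<-irrefl refl ∘ proj₂ ] refl [ y≮x , ℕ.<-irrefl refl ∘ proj₂ ]
...   | tri> _ d≢c c<d = tri> [ y≮x , ℕ.<-asym c<d ∘ proj₂ ]
                              (d≢c ∘ ≡.sym ∘ ℕ.suc-injective ∘ cong proj₂) (inj₂ (refl , c<d))

⊏-isStrictTotalOrder : IsStrictTotalOrder _≡_ _⊏_
⊏-isStrictTotalOrder = isStrictTotalOrderᶜ record
  { isEquivalence = ≡.isEquivalence ; trans = ⊏-trans ; compare = ⊏-compare }

module ⊏ = IsStrictTotalOrder ⊏-isStrictTotalOrder

module _ {r n : ℕ} where

  _<ᴷ_ : Rel (Key r n) 0ℓ
  _<ᴷ_ = ×-Lex _≡_ _<_ (_⊏_ on entry)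

  <ᴷ-isStrictTotalOrder : IsStrictTotalOrder (Pointwise _≡_ (_≡_ on entry)) _<ᴷ_
  <ᴷ-isStrictTotalOrder =
    ×-isStrictTotalOrder ℕ.<-isStrictTotalOrder (On.isStrictTotalOrder entry ⊏-isStrictTotalOrder)

  module <ᴷ = IsStrictTotalOrder <ᴷ-isStrictTotalOrder

  ≤ᵏ-reflects-<ᴷ : ∀ k k′ → Reflects (k <ᴷ k′) (k ≤ᵏ k′)
  ≤ᵏ-reflects-<ᴷ (ν , a) (μ , b) =
    ℕ.<ᵇ-reflects-< ν μ ⊎-reflects
    (fromEquivalence (ℕ.≡ᵇ⇒≡ ν μ) (ℕ.≡⇒≡ᵇ ν μ) ×-reflects <ᶜ-reflects-⊏ (entry a) (entry b))

  keyIndex : Key r n → Fin n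
  keyIndex = proj₁ ∘ proj₂

  <ᴷ-connex : ∀ {k k′} → keyIndex k ≢ keyIndex k′ → ¬ k <ᴷ k′ → k′ <ᴷ k
  <ᴷ-connex {k} {k′} k≢k′ k≮k′ with <ᴷ.compare k k′
  ... | tri< k<k′ _ _ = contradiction k<k′ k≮k′
  ... | tri≈ _ (_ , e) _ = contradiction (Fin.toℕ-injective (ℕ.suc-injective (cong proj₁ e))) k≢k′
  ... | tri> _ _ k′<k = k′<k

  Sorted : ∀ {m} → Vec (Key r n) m → Set
  Sorted = AllPairs _<ᴷ_

  Distinct : ∀ {m} → Vec (Key r n) m → Set
  Distinct = AllPairs (_≢_ on keyIndex)

  insert-All : ∀ {P : Key r n → Set} {m k} {xs : Vec (Key r n) m} →
               P k → All P xs → All P (insert k xs)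
  insert-All {xs = []} pk [] = pk ∷ []
  insert-All {k = k} {x ∷ xs} pk (px ∷ pxs) with k ≤ᵏ x
  ... | true  = pk ∷ px ∷ pxs
  ... | false = px ∷ insert-All pk pxs

  isort-All : ∀ {P : Key r n → Set} {m} {xs : Vec (Key r n) m} → All P xs → All P (isort xs)
  isort-All [] = []
  isort-All (px ∷ pxs) = insert-All px (isort-All pxs)

  ∈-insert⁺ : ∀ {m k z} {xs : Vec (Key r n) m} → z ≡ k ⊎ z ∈ xs → z ∈ insert k xs
  ∈-insert⁺ {xs = []} (inj₁ z≡k) = here z≡k
  ∈-insert⁺ {k = k} {xs = x ∷ xs} z∈k∷xs with k ≤ᵏ x | z∈k∷xs
  ... | true  | inj₁ z≡k           = here z≡k
  ... | true  | inj₂ z∈xs          = there z∈xs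
  ... | false | inj₁ z≡k           = there (∈-insert⁺ {xs = xs} (inj₁ z≡k))
  ... | false | inj₂ (here z≡x)    = here z≡x
  ... | false | inj₂ (there z∈xs)  = there (∈-insert⁺ {xs = xs} (inj₂ z∈xs))

  ∈-isort⁺ : ∀ {m z} {xs : Vec (Key r n) m} → z ∈ xs → z ∈ isort xs
  ∈-isort⁺ {xs = x ∷ xs} (here z≡x)   = ∈-insert⁺ {xs = isort xs} (inj₁ z≡x)
  ∈-isort⁺ {xs = x ∷ xs} (there z∈xs) = ∈-insert⁺ {xs = isort xs} (inj₂ (∈-isort⁺ z∈xs))

  ∈-isort⁻ : ∀ {m z} {xs : Vec (Key r n) m} → z ∈ isort xs → z ∈ xs
  ∈-isort⁻ {xs = xs} = All.lookup (isort-All {P = _∈ xs} {xs = xs} (AllP.lookup⁻ (λ i → ∈-lookup i xs)))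

  isort-AllPairs : ∀ {R : Rel (Key r n) 0ℓ} → Symmetric R →
                   ∀ {m} {xs : Vec (Key r n) m} → AllPairs R xs → AllPairs R (isort xs)
  isort-AllPairs sym [] = []
  isort-AllPairs {R} sym (Rxs ∷ pxs) = insert-AllPairs (isort-All Rxs) (isort-AllPairs sym pxs)
    where
    insert-AllPairs : ∀ {m k} {xs : Vec (Key r n) m} →
                      All (R k) xs → AllPairs R xs → AllPairs R (insert k xs)
    insert-AllPairs {xs = []} _ [] = [] ∷ []
    insert-AllPairs {k = k} {x ∷ xs} (Rkx ∷ Rkxs) (Rxxs ∷ pxs) with k ≤ᵏ x
    ... | true  = (Rkx ∷ Rkxs) ∷ Rxxs ∷ pxs
    ... | false = insert-All (sym Rkx) Rxxs ∷ insert-AllPairs Rkxs pxs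

  insert-Sorted : ∀ {m k} {xs : Vec (Key r n) m} →
                  All ((_≢_ on keyIndex) k) xs → Sorted xs → Sorted (insert k xs)
  insert-Sorted {xs = []} _ [] = [] ∷ []
  insert-Sorted {k = k} {x ∷ xs} (k≢x ∷ k≢xs) (x<xs ∷ sxs) with k ≤ᵏ x | ≤ᵏ-reflects-<ᴷ k x
  ... | true  | ofʸ k<x = (k<x ∷ All.map (<ᴷ.trans k<x) x<xs) ∷ x<xs ∷ sxs
  ... | false | ofⁿ k≮x = insert-All (<ᴷ-connex k≢x k≮x) x<xs ∷ insert-Sorted k≢xs sxs

  isort-Sorted : ∀ {m} {xs : Vec (Key r n) m} → Distinct xs → Sorted (isort xs)
  isort-Sorted [] = []
  isort-Sorted (k≢xs ∷ dxs) = insert-Sorted (isort-All k≢xs) (isort-Sorted dxs)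

  module _ (_∙_ : ℕ → ℕ → ℕ) (assoc : Associative _≡_ _∙_) (comm : Commutative _≡_ _∙_) (e : ℕ) where

    foldr-insert : ∀ {m} k (xs : Vec (Key r n) m) →
      Vec.foldr _ _∙_ e (Vec.map proj₁ (insert k xs)) ≡ proj₁ k ∙ Vec.foldr _ _∙_ e (Vec.map proj₁ xs)
    foldr-insert k [] = refl
    foldr-insert k (x ∷ xs) with k ≤ᵏ x
    ... | true  = refl
    ... | false = begin
      proj₁ x ∙ Vec.foldr _ _∙_ e (Vec.map proj₁ (insert k xs)) ≡⟨ cong (proj₁ x ∙_) (foldr-insert k xs) ⟩
      proj₁ x ∙ (proj₁ k ∙ rest)  ≡⟨ assoc (proj₁ x) (proj₁ k) rest ⟨
      (proj₁ x ∙ proj₁ k) ∙ rest  ≡⟨ cong (_∙ rest) (comm (proj₁ x) (proj₁ k)) ⟩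
      (proj₁ k ∙ proj₁ x) ∙ rest  ≡⟨ assoc (proj₁ k) (proj₁ x) rest ⟩
      proj₁ k ∙ (proj₁ x ∙ rest)  ∎
      where
      open ≡.≡-Reasoning
      rest = Vec.foldr _ _∙_ e (Vec.map proj₁ xs)

    foldr-isort : ∀ {m} (xs : Vec (Key r n) m) →
      Vec.foldr _ _∙_ e (Vec.map proj₁ (isort xs)) ≡ Vec.foldr _ _∙_ e (Vec.map proj₁ xs)
    foldr-isort [] = refl
    foldr-isort (x ∷ xs) = ≡.trans (foldr-insert x (isort xs)) (cong (proj₁ x ∙_) (foldr-isort xs))

-- Descents

indicator : Bool → ℕ
indicator true  = 1
indicator false = 0

length-consIf : ∀ b (o : ℕ) D →
                List.length (if b then o List.∷ D else D) ≡ indicator b ℕ.+ List.length D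
length-consIf true  o D = refl
length-consIf false o D = refl

sum-consIf : ∀ b o D → sum (if b then o List.∷ D else D) ≡ indicator b * o ℕ.+ sum D
sum-consIf true  o D = cong (ℕ._+ sum D) (≡.sym (ℕ.+-identityʳ o))
sum-consIf false o D = refl

countLe-consIf : ∀ b {o k} D → o ≤ k →
                 countLe k (if b then o List.∷ D else D) ≡ indicator b ℕ.+ countLe k D
countLe-consIf true  {k = k} D o≤k = cong List.length (List.filter-accept (ℕ._≤? k) o≤k)
countLe-consIf false         D o≤k = refl

descent : CInt → CInt → ℕ
descent p q = indicator (q <ᶜ p)

module _ {r n : ℕ} where

  descentsFrom : ∀ {m} → ℕ → CInt → Vec (Fin n × Fin r) m → List ℕ
  descentsFrom o p w = desAux o (p List.∷ List.map entry (Vec.toList w))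

  descentCounts : ∀ {m} → ℕ → CInt → Vec (Fin n × Fin r) m → Vec ℕ m
  descentCounts c p []      = []
  descentCounts c p (a ∷ w) = c ℕ.+ descent p (entry a) ∷ descentCounts (c ℕ.+ descent p (entry a)) (entry a) w

  countLe-descentsFrom-< : ∀ {m k} o p (w : Vec (Fin n × Fin r) m) → k < o → countLe k (descentsFrom o p w) ≡ 0
  countLe-descentsFrom-< o p []      k<o = refl
  countLe-descentsFrom-< {k = k} o p (a ∷ w) k<o with entry a <ᶜ p
  ... | true  = ≡.trans (cong List.length (List.filter-reject (ℕ._≤? k) (ℕ.<⇒≱ k<o)))
                        (countLe-descentsFrom-< (suc o) (entry a) w (ℕ.m<n⇒m<1+n k<o))
  ... | false = countLe-descentsFrom-< (suc o) (entry a) w (ℕ.m<n⇒m<1+n k<o)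

  lookup-descentCounts : ∀ {m} c p o (w : Vec (Fin n × Fin r) m) i →
                         lookup (descentCounts c p w) i ≡ c ℕ.+ countLe (o ℕ.+ toℕ i) (descentsFrom o p w)
  lookup-descentCounts c p o (a ∷ w) Fin.zero = cong (c ℕ.+_) (≡.sym (begin
    countLe (o ℕ.+ 0) (descentsFrom o p (a ∷ w))
      ≡⟨ countLe-consIf (entry a <ᶜ p) (descentsFrom (suc o) (entry a) w) (ℕ.m≤m+n o 0) ⟩
    descent p (entry a) ℕ.+ countLe (o ℕ.+ 0) (descentsFrom (suc o) (entry a) w)
      ≡⟨ cong (descent p (entry a) ℕ.+_) (countLe-descentsFrom-< (suc o) (entry a) w o+0<1+o) ⟩
    descent p (entry a) ℕ.+ 0
      ≡⟨ ℕ.+-identityʳ _ ⟩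
    descent p (entry a) ∎))
    where
    open ≡.≡-Reasoning
    o+0<1+o : o ℕ.+ 0 < suc o
    o+0<1+o = s≤s (ℕ.≤-reflexive (ℕ.+-identityʳ o))
  lookup-descentCounts c p o (a ∷ w) (Fin.suc i) = begin
    lookup (descentCounts (c ℕ.+ β) (entry a) w) i
      ≡⟨ lookup-descentCounts (c ℕ.+ β) (entry a) (suc o) w i ⟩
    c ℕ.+ β ℕ.+ countLe (suc o ℕ.+ toℕ i) D
      ≡⟨ ℕ.+-assoc c β _ ⟩
    c ℕ.+ (β ℕ.+ countLe (suc o ℕ.+ toℕ i) D)
      ≡⟨ cong (λ k → c ℕ.+ (β ℕ.+ countLe k D)) (ℕ.+-suc o (toℕ i)) ⟨
    c ℕ.+ (β ℕ.+ countLe (o ℕ.+ suc (toℕ i)) D)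
      ≡⟨ cong (c ℕ.+_) (countLe-consIf (entry a <ᶜ p) D (ℕ.m≤m+n o _)) ⟨
    c ℕ.+ countLe (o ℕ.+ suc (toℕ i)) (descentsFrom o p (a ∷ w)) ∎
    where
    open ≡.≡-Reasoning
    β = descent p (entry a)
    D = descentsFrom (suc o) (entry a) w

  sum-descentCounts : ∀ {m} c p o (w : Vec (Fin n × Fin r) m) →
    Vec.sum (descentCounts c p w) ℕ.+ sum (descentsFrom o p w)
      ≡ m * c ℕ.+ (m ℕ.+ o) * List.length (descentsFrom o p w)
  sum-descentCounts c p o [] = ≡.sym (ℕ.*-zeroʳ o)
  sum-descentCounts {suc m} c p o (a ∷ w) = begin
    (c ℕ.+ β ℕ.+ S) ℕ.+ sum (descentsFrom o p (a ∷ w))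
      ≡⟨ cong ((c ℕ.+ β ℕ.+ S) ℕ.+_) (sum-consIf (entry a <ᶜ p) o D) ⟩
    (c ℕ.+ β ℕ.+ S) ℕ.+ (β * o ℕ.+ sum D)
      ≡⟨ regroup c β S (sum D) o ⟩
    (c ℕ.+ β ℕ.+ β * o) ℕ.+ (S ℕ.+ sum D)
      ≡⟨ cong ((c ℕ.+ β ℕ.+ β * o) ℕ.+_) (sum-descentCounts (c ℕ.+ β) (entry a) (suc o) w) ⟩
    (c ℕ.+ β ℕ.+ β * o) ℕ.+ (m * (c ℕ.+ β) ℕ.+ (m ℕ.+ suc o) * List.length D)
      ≡⟨ collect c β m o (List.length D) ⟩
    suc m * c ℕ.+ (suc m ℕ.+ o) * (β ℕ.+ List.length D)
      ≡⟨ cong (λ L → suc m * c ℕ.+ (suc m ℕ.+ o) * L) (length-consIf (entry a <ᶜ p) o D) ⟨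
    suc m * c ℕ.+ (suc m ℕ.+ o) * List.length (descentsFrom o p (a ∷ w)) ∎
    where
    open ≡.≡-Reasoning
    β = descent p (entry a)
    D = descentsFrom (suc o) (entry a) w
    S = Vec.sum (descentCounts (c ℕ.+ β) (entry a) w)
    regroup : ∀ c β S T o → (c ℕ.+ β ℕ.+ S) ℕ.+ (β * o ℕ.+ T) ≡ (c ℕ.+ β ℕ.+ β * o) ℕ.+ (S ℕ.+ T)
    regroup = ℕ-Solver.solve-∀
    collect : ∀ c β m o L → (c ℕ.+ β ℕ.+ β * o) ℕ.+ (m * (c ℕ.+ β) ℕ.+ (m ℕ.+ suc o) * L)
                            ≡ suc m * c ℕ.+ (suc m ℕ.+ o) * (β ℕ.+ L)
    collect = ℕ-Solver.solve-∀

  lastOr-descentCounts : ∀ {m} c p o (w : Vec (Fin n × Fin r) m) →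
                         lastOr c (descentCounts c p w) ≡ c ℕ.+ List.length (descentsFrom o p w)
  lastOr-descentCounts c p o []      = ≡.sym (ℕ.+-identityʳ c)
  lastOr-descentCounts c p o (a ∷ w) = begin
    lastOr (c ℕ.+ β) (descentCounts (c ℕ.+ β) (entry a) w)
      ≡⟨ lastOr-descentCounts (c ℕ.+ β) (entry a) (suc o) w ⟩
    c ℕ.+ β ℕ.+ List.length D
      ≡⟨ ℕ.+-assoc c β _ ⟩
    c ℕ.+ (β ℕ.+ List.length D)
      ≡⟨ cong (c ℕ.+_) (length-consIf (entry a <ᶜ p) o D) ⟨
    c ℕ.+ List.length (descentsFrom o p (a ∷ w)) ∎
    where
    open ≡.≡-Reasoning
    β = descent p (entry a)
    D = descentsFrom (suc o) (entry a) w

-- Admissible key sequences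

-- Consecutive keys of a sorted tuple: the value may repeat only where there is no descent.
Ascent : Rel (ℕ × CInt) 0ℓ
Ascent (u , p) (v , q) = u ℕ.+ descent p q ≤ v

-- The pseudo-key in front: value 0 at γ(0) = 0.
origin : ℕ × CInt
origin = 0 , (0 , 0)

ZeroUncolored : ℕ × CInt → Set
ZeroUncolored (v , (_ , c)) = v ≡ 0 → c ≡ 0

Ascent-origin : ∀ v y c → ZeroUncolored (v , (suc y , c)) → Ascent origin (v , (suc y , c))
Ascent-origin v       y zero    _       = z≤n
Ascent-origin zero    y (suc c) v≡0⇒c≡0 = contradiction (v≡0⇒c≡0 refl) λ ()
Ascent-origin (suc v) y (suc c) _       = s≤s z≤n

Ascent-ZeroUncolored : ∀ {u p v q} → Ascent (u , p) (v , q) → ZeroUncolored (u , p) → ZeroUncolored (v , q)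
Ascent-ZeroUncolored {u} {x , c} {v} {y , zero}  _   _   _   = refl
Ascent-ZeroUncolored {u} {x , c} {v} {y , suc d} asc u⇒c refl
  with refl ← ℕ.n≤0⇒n≡0 (ℕ.m+n≤o⇒m≤o u asc)
  with refl ← u⇒c refl = contradiction asc λ ()

Linked-Ascent-ZeroUncolored : ∀ {m q} {qs : Vec (ℕ × CInt) m} →
                              Linked Ascent (q ∷ qs) → ZeroUncolored q → All ZeroUncolored qs
Linked-Ascent-ZeroUncolored {qs = []}     _             _  = []
Linked-Ascent-ZeroUncolored {qs = _ ∷ _} (asc ∷ ascs) zq =
  zq′ ∷ Linked-Ascent-ZeroUncolored ascs zq′
  where zq′ = Ascent-ZeroUncolored asc zq

module _ {r n : ℕ} where

  point : Key r n → ℕ × CInt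
  point (v , a) = v , entry a

  <ᴷ⇒Ascent : ∀ {k k′ : Key r n} → k <ᴷ k′ → Ascent (point k) (point k′)
  <ᴷ⇒Ascent {u , a} {v , b} (inj₁ u<v) with entry b <ᶜ entry a
  ... | true  = ℕ.≤-trans (ℕ.≤-reflexive (ℕ.+-comm u 1)) u<v
  ... | false = ℕ.≤-trans (ℕ.≤-reflexive (ℕ.+-identityʳ u)) (ℕ.<⇒≤ u<v)
  <ᴷ⇒Ascent {u , a} {v , b} (inj₂ (refl , a⊏b)) with entry b <ᶜ entry a | <ᶜ-reflects-⊏ (entry b) (entry a)
  ... | true  | ofʸ b⊏a = contradiction b⊏a (⊏.asym a⊏b)
  ... | false | _       = ℕ.≤-reflexive (ℕ.+-identityʳ u)

  Ascent⇒≯ᴷ : ∀ {k k′ : Key r n} → Ascent (point k) (point k′) → ¬ k′ <ᴷ k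
  Ascent⇒≯ᴷ {u , a} {v , b} asc (inj₁ v<u) = ℕ.<⇒≱ v<u (ℕ.m+n≤o⇒m≤o u asc)
  Ascent⇒≯ᴷ {u , a} {v , b} asc (inj₂ (refl , b⊏a)) with entry b <ᶜ entry a | <ᶜ-reflects-⊏ (entry b) (entry a)
  ... | true  | _       = ℕ.m+1+n≰m u asc
  ... | false | ofⁿ b⋢a = b⋢a b⊏a

  Ascent⇒<ᴷ : ∀ {k k′ : Key r n} → keyIndex k ≢ keyIndex k′ → Ascent (point k) (point k′) → k <ᴷ k′
  Ascent⇒<ᴷ {k} {k′} k≢k′ asc with k ≤ᵏ k′ | ≤ᵏ-reflects-<ᴷ k k′
  ... | true  | ofʸ k<k′ = k<k′
  ... | false | ofⁿ k≮k′ = contradiction (<ᴷ-connex k≢k′ k≮k′) (Ascent⇒≯ᴷ asc)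

  Sorted⇒Linked-Ascent : ∀ {m k} {ks : Vec (Key r n) m} → Sorted (k ∷ ks) →
                         Linked Ascent (point k ∷ Vec.map point ks)
  Sorted⇒Linked-Ascent {ks = []}     _                     = [-]
  Sorted⇒Linked-Ascent {ks = _ ∷ _} ((k<k′ ∷ _) ∷ k′∷ks↑) =
    <ᴷ⇒Ascent k<k′ ∷ Sorted⇒Linked-Ascent k′∷ks↑

  Linked-Ascent⇒Sorted : ∀ {m} {ks : Vec (Key r n) m} → Distinct ks → Linked Ascent (Vec.map point ks) → Sorted ks
  Linked-Ascent⇒Sorted {ks = []}         []            _            = []
  Linked-Ascent⇒Sorted {ks = _ ∷ []}     ([] ∷ [])     _            = [] ∷ []
  Linked-Ascent⇒Sorted {ks = _ ∷ _ ∷ _} ((k≢k′ ∷ _) ∷ dks) (asc ∷ ascs) with Linked-Ascent⇒Sorted dks ascs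
  ... | k′<ks ∷ ks↑ = (k<k′ ∷ All.map (<ᴷ.trans k<k′) k′<ks) ∷ k′<ks ∷ ks↑
    where k<k′ = Ascent⇒<ᴷ k≢k′ asc

  Linked-Ascent⇒values : ∀ {m q} {ks : Vec (Key r n) m} → Linked Ascent (q ∷ Vec.map point ks) →
                         Linked _≤_ (proj₁ q ∷ Vec.map proj₁ ks)
  Linked-Ascent⇒values {ks = []}     _            = [-]
  Linked-Ascent⇒values {q = u , _} {ks = _ ∷ _} (asc ∷ ascs) =
    ℕ.m+n≤o⇒m≤o u asc ∷ Linked-Ascent⇒values ascs

  Admissible : ∀ {m} → Vec (Key r n) m → Set
  Admissible ks = Linked Ascent (origin ∷ Vec.map point ks)

  Sorted⇒Admissible : ∀ {m} {ks : Vec (Key r n) m} → Sorted ks → All (ZeroUncolored ∘ point) ks → Admissible ks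
  Sorted⇒Admissible {ks = []}    []  []       = [-]
  Sorted⇒Admissible {ks = _ ∷ _} ks↑ (zk ∷ _) = Ascent-origin _ _ _ zk ∷ Sorted⇒Linked-Ascent ks↑

  -- λ of a key sequence that follows c descents and the entry p; `lam≡lamOf` is the case c = 0, p = γ(0).
  lamOf : ∀ {m} → ℕ → CInt → Vec (Key r n) m → Vec ℤ m
  lamOf c p ks = Vec.zipWith _⊝_ (Vec.map proj₁ ks) (descentCounts c p (Vec.map proj₂ ks))

  lamOf-nondecreasing : ∀ {m u} c p {ks : Vec (Key r n) m} → Linked Ascent ((u , p) ∷ Vec.map point ks) →
                        Linked ℤ._≤_ (u ⊝ c ∷ lamOf c p ks)
  lamOf-nondecreasing c p {[]}          _            = [-]
  lamOf-nondecreasing c p {(v , a) ∷ _} (asc ∷ ascs) =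
    ⊝-mono c (descent p (entry a)) asc ∷ lamOf-nondecreasing (c ℕ.+ descent p (entry a)) (entry a) ascs

  -- The inverse of lamOf over the window w: values λ_k + d_k.
  unlam : ∀ {m} → ℕ → CInt → Vec ℤ m → Vec (Fin n × Fin r) m → Vec (Key r n) m
  unlam c p l w = Vec.zip (Vec.zipWith (λ z d → ℤ.∣ z ∣ ℕ.+ d) l (descentCounts c p w)) w

  map-proj₂-unlam : ∀ {m} c p (l : Vec ℤ m) w → Vec.map proj₂ (unlam c p l w) ≡ w
  map-proj₂-unlam c p l w = Vec.map-proj₂-zip _ w

  lamOf-unlam : ∀ {m} c p (l : Vec ℤ m) w → All (+ 0 ℤ.≤_) l → lamOf c p (unlam c p l w) ≡ l
  lamOf-unlam c p l w 0≤l = begin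
    Vec.zipWith _⊝_ (Vec.map proj₁ (Vec.zip vs w)) (descentCounts c p (Vec.map proj₂ (Vec.zip vs w)))
      ≡⟨ ≡.cong₂ (λ vs′ w′ → Vec.zipWith _⊝_ vs′ (descentCounts c p w′))
                 (Vec.map-proj₁-zip vs w) (Vec.map-proj₂-zip vs w) ⟩
    Vec.zipWith _⊝_ vs (descentCounts c p w)
      ≡⟨ zipWith-⊝-lift l (descentCounts c p w) 0≤l ⟩
    l ∎
    where
    open ≡.≡-Reasoning
    vs = Vec.zipWith (λ z d → ℤ.∣ z ∣ ℕ.+ d) l (descentCounts c p w)

  unlam-Linked-Ascent : ∀ {m a} c p {l : Vec ℤ m} (w : Vec (Fin n × Fin r) m) → Linked ℤ._≤_ (+ a ∷ l) →
                        Linked Ascent ((a ℕ.+ c , p) ∷ Vec.map point (unlam c p l w))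
  unlam-Linked-Ascent c p {[]}    []      _                  = [-]
  unlam-Linked-Ascent {a = a} c p {_ ∷ _} (b ∷ w) (ℤ.+≤+ a≤v ∷ l↑) =
    ℕ.≤-trans (ℕ.≤-reflexive (ℕ.+-assoc a c β)) (ℕ.+-monoˡ-≤ (c ℕ.+ β) a≤v)
    ∷ unlam-Linked-Ascent (c ℕ.+ β) (entry b) w l↑
    where β = descent p (entry b)

  sortedKeys : CTuple r n → Vec (Key r n) n
  sortedKeys f = isort (keys f)

  ∈-keys : ∀ {f : CTuple r n} {k} → k ∈ keys f → lookup f (keyIndex k) ≡ (proj₁ k , proj₂ (proj₂ k))
  ∈-keys k∈keys with AnyP.tabulate⁻ k∈keys
  ... | _ , refl = refl

  lookup-keys-∈ : ∀ (f : CTuple r n) j → (proj₁ (lookup f j) , (j , proj₂ (lookup f j))) ∈ keys f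
  lookup-keys-∈ f j = AnyP.tabulate⁺ j refl

  keys-Distinct : ∀ (f : CTuple r n) → Distinct (keys f)
  keys-Distinct f = AllPairsP.tabulate⁺ (λ i≢j → i≢j)

  sortedKeys-Sorted : ∀ (f : CTuple r n) → Sorted (sortedKeys f)
  sortedKeys-Sorted f = isort-Sorted (keys-Distinct f)

  sortedKeys-injective : ∀ {f g : CTuple r n} → sortedKeys f ≡ sortedKeys g → f ≡ g
  sortedKeys-injective {f} {g} eq = lookup-ext λ j →
    ≡.sym (∈-keys {g} (∈-isort⁻ {xs = keys g} (≡.subst (_ ∈_) eq (∈-isort⁺ (lookup-keys-∈ f j)))))

  lam≡lamOf : ∀ (f : CTuple r n) → lam f ≡ lamOf 0 (0 , 0) (sortedKeys f)
  lam≡lamOf f = ≡.trans (Vec.tabulate-cong lamᵢ) (Vec.tabulate∘lookup _)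
    where
    open ≡.≡-Reasoning
    s = sortedKeys f
    lamᵢ : ∀ i → proj₁ (lookup f (proj₁ (lookup (π f) i))) ⊝ countLe (toℕ i) (Des (π f))
                 ≡ lookup (lamOf 0 (0 , 0) s) i
    lamᵢ i = begin
      proj₁ (lookup f (proj₁ (lookup (π f) i))) ⊝ countLe (toℕ i) (Des (π f))
        ≡⟨ cong (λ a → proj₁ (lookup f (proj₁ a)) ⊝ countLe (toℕ i) (Des (π f)))
                (Vec.lookup-map i proj₂ s) ⟩
      proj₁ (lookup f (keyIndex (lookup s i))) ⊝ countLe (toℕ i) (Des (π f))
        ≡⟨ ≡.cong₂ _⊝_ (cong proj₁ (∈-keys {f} (∈-isort⁻ {xs = keys f} (∈-lookup i s))))
                       (≡.sym (lookup-descentCounts 0 (0 , 0) 0 (π f) i)) ⟩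
      proj₁ (lookup s i) ⊝ lookup (descentCounts 0 (0 , 0) (π f)) i
        ≡⟨ cong (_⊝ lookup (descentCounts 0 (0 , 0) (π f)) i) (Vec.lookup-map i proj₁ s) ⟨
      lookup (Vec.map proj₁ s) i ⊝ lookup (descentCounts 0 (0 , 0) (π f)) i
        ≡⟨ Vec.lookup-zipWith _⊝_ i (Vec.map proj₁ s) (descentCounts 0 (0 , 0) (π f)) ⟨
      lookup (lamOf 0 (0 , 0) s) i ∎

  Distinct⇒IsColoredPerm : ∀ {ks : Vec (Key r n) n} → Distinct ks → IsColoredPerm (Vec.map proj₂ ks)
  Distinct⇒IsColoredPerm dks = AllPairs-≢-on⇒injective {g = proj₁} (AllPairsP.map⁺ {f = proj₂} dks)

  IsColoredPerm⇒Distinct : ∀ {ks : Vec (Key r n) n} → IsColoredPerm (Vec.map proj₂ ks) → Distinct ks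
  IsColoredPerm⇒Distinct {ks} perm = injective⇒AllPairs-≢-on λ i j eq →
    perm i j (≡.trans (proj₁-lookup i) (≡.trans eq (≡.sym (proj₁-lookup j))))
    where
    proj₁-lookup : ∀ i → proj₁ (lookup (Vec.map proj₂ ks) i) ≡ keyIndex (lookup ks i)
    proj₁-lookup i = cong proj₁ (Vec.lookup-map i proj₂ ks)

  Distinct⇒keys : ∀ (ks : Vec (Key r n) n) → Distinct ks →
                  ∃ λ f → (∀ {k} → k ∈ keys f → k ∈ ks) × (∀ {k} → k ∈ ks → k ∈ keys f)
  Distinct⇒keys ks dks = f , keys⊆ks , ks⊆keys
    where
    σ : Fin n → Fin n
    σ i = proj₁ (lookup (Vec.map proj₂ ks) i)
    σ-injective : ∀ i j → σ i ≡ σ j → i ≡ j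
    σ-injective = Distinct⇒IsColoredPerm dks
    τ : Fin n → Fin n
    τ j = proj₁ (injective⇒surjective σ σ-injective j)
    σ∘τ : ∀ j → σ (τ j) ≡ j
    σ∘τ j = proj₂ (injective⇒surjective σ σ-injective j)
    τ∘σ : ∀ i → τ (σ i) ≡ i
    τ∘σ i = σ-injective _ _ (σ∘τ (σ i))
    keyAt : Fin n → ℕ × Fin r
    keyAt j = proj₁ (lookup ks (τ j)) , proj₂ (proj₂ (lookup ks (τ j)))
    f : CTuple r n
    f = tabulate keyAt
    lookup-keys : ∀ j → (proj₁ (lookup f j) , (j , proj₂ (lookup f j))) ≡ lookup ks (τ j)
    lookup-keys j rewrite Vec.lookup∘tabulate keyAt j =
      cong (λ i → proj₁ (lookup ks (τ j)) , (i , proj₂ (proj₂ (lookup ks (τ j)))))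
           (≡.trans (≡.sym (σ∘τ j)) (cong proj₁ (Vec.lookup-map (τ j) proj₂ ks)))
    keys⊆ks : ∀ {k} → k ∈ keys f → k ∈ ks
    keys⊆ks k∈keys with AnyP.tabulate⁻ k∈keys
    ... | j , refl = ≡.subst (_∈ ks) (≡.sym (lookup-keys j)) (∈-lookup (τ j) ks)
    ks⊆keys : ∀ {k} → k ∈ ks → k ∈ keys f
    ks⊆keys k∈ks = AnyP.tabulate⁺ (σ i) (≡.trans (AnyP.lookup-index k∈ks)
      (≡.trans (cong (lookup ks) (≡.sym (τ∘σ i))) (≡.sym (lookup-keys (σ i)))))
      where i = Any.index k∈ks

  Admissible⇒sortedKeys : ∀ (ks : Vec (Key r n) n) → Distinct ks → Admissible ks →
                          ∃ λ f → InN0 f × sortedKeys f ≡ ks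
  Admissible⇒sortedKeys ks dks asc with Distinct⇒keys ks dks
  ... | f , keys⊆ks , ks⊆keys = f , f∈N0 , sortedKeys≡ks
    where
    ks-ZeroUncolored : All (ZeroUncolored ∘ point) ks
    ks-ZeroUncolored = AllP.map⁻ (Linked-Ascent-ZeroUncolored asc (λ _ → refl))
    f∈N0 : InN0 f
    f∈N0 j = All.lookup ks-ZeroUncolored (keys⊆ks (lookup-keys-∈ f j))
    sortedKeys≡ks : sortedKeys f ≡ ks
    sortedKeys≡ks = AllPairs-unique <ᴷ.asym (sortedKeys-Sorted f) (Linked-Ascent⇒Sorted dks (Linked.tail asc))
      (λ k∈ → keys⊆ks (∈-isort⁻ {xs = keys f} k∈)) (λ k∈ → ∈-isort⁺ (ks⊆keys k∈))

  Sorted⇒values : ∀ {m} {ks : Vec (Key r n) m} → Sorted ks → Linked _≤_ (0 ∷ Vec.map proj₁ ks)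
  Sorted⇒values {ks = []}    []  = [-]
  Sorted⇒values {ks = _ ∷ _} ks↑ = z≤n ∷ Linked-Ascent⇒values (Sorted⇒Linked-Ascent ks↑)

  map-proj₁-keys : ∀ (f : CTuple r n) → Vec.map proj₁ (keys f) ≡ Vec.map proj₁ f
  map-proj₁-keys f = begin
    Vec.map proj₁ (keys f)                       ≡⟨ Vec.tabulate-∘ proj₁ _ ⟨
    tabulate (λ i → proj₁ (lookup f i))          ≡⟨ Vec.tabulate-cong (λ i → Vec.lookup-map i proj₁ f) ⟨
    tabulate (lookup (Vec.map proj₁ f))          ≡⟨ Vec.tabulate∘lookup _ ⟩
    Vec.map proj₁ f                              ∎
    where open ≡.≡-Reasoning

  foldr-sortedKeys : ∀ (_∙_ : ℕ → ℕ → ℕ) → Associative _≡_ _∙_ → Commutative _≡_ _∙_ →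
                     ∀ e (f : CTuple r n) →
                     Vec.foldr _ (λ p acc → proj₁ p ∙ acc) e f ≡ Vec.foldr _ _∙_ e (Vec.map proj₁ (sortedKeys f))
  foldr-sortedKeys _∙_ assoc comm e f = begin
    Vec.foldr _ (λ p acc → proj₁ p ∙ acc) e f          ≡⟨ foldr-proj₁ _∙_ e f ⟩
    Vec.foldr _ _∙_ e (Vec.map proj₁ f)                ≡⟨ cong (Vec.foldr _ _∙_ e) (map-proj₁-keys f) ⟨
    Vec.foldr _ _∙_ e (Vec.map proj₁ (keys f))         ≡⟨ foldr-isort _∙_ assoc comm e (keys f) ⟨
    Vec.foldr _ _∙_ e (Vec.map proj₁ (sortedKeys f))   ∎
    where open ≡.≡-Reasoning

  lam-InP : ∀ {f : CTuple r n} → InN0 f → InP (lam f)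
  lam-InP {f} f∈N0 = ≡.subst InP (≡.sym (lam≡lamOf f)) (Linked⇒InP (lamOf-nondecreasing 0 (0 , 0)
    (Sorted⇒Admissible (sortedKeys-Sorted f) (isort-All (AllP.tabulate⁺ f∈N0)))))

  maxF≡maxP+des : ∀ (f : CTuple r n) → + maxF f ≡ maxP (lam f) + + des (π f)
  maxF≡maxP+des f = begin
    + maxF f
      ≡⟨ cong +_ (foldr-sortedKeys ℕ._⊔_ ℕ.⊔-assoc ℕ.⊔-comm 0 f) ⟩
    + Vec.foldr _ ℕ._⊔_ 0 vs
      ≡⟨ cong +_ (⊔-foldr-nondecreasing 0 vs (Sorted⇒values (sortedKeys-Sorted f))) ⟩
    + lastOr 0 vs
      ≡⟨ i-j+j≡i (+ lastOr 0 vs) (+ des (π f)) ⟨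
    lastOr 0 vs ⊝ des (π f) + + des (π f)
      ≡⟨ cong (λ d → lastOr 0 vs ⊝ d + + des (π f)) (lastOr-descentCounts 0 (0 , 0) 0 (π f)) ⟨
    lastOr 0 vs ⊝ lastOr 0 ds + + des (π f)
      ≡⟨ cong (λ m → m + + des (π f)) (lastOr-zipWith _⊝_ 0 0 vs ds) ⟨
    lastOr (+ 0) (lamOf 0 (0 , 0) s) + + des (π f)
      ≡⟨ cong (λ m → m + + des (π f)) (maxP≡lastOr (lamOf 0 (0 , 0) s)) ⟨
    maxP (lamOf 0 (0 , 0) s) + + des (π f)
      ≡⟨ cong (λ l → maxP l + + des (π f)) (lam≡lamOf f) ⟨
    maxP (lam f) + + des (π f) ∎
    where
    open ≡.≡-Reasoning
    s = sortedKeys f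
    vs = Vec.map proj₁ s
    ds = descentCounts 0 (0 , 0) (π f)

  sumF≡sumP+n*des-maj : ∀ (f : CTuple r n) → + sumF f ≡ (sumP (lam f) + + (n * des (π f))) - + maj (π f)
  sumF≡sumP+n*des-maj f = begin
    + sumF f
      ≡⟨ cong +_ (foldr-sortedKeys ℕ._+_ ℕ.+-assoc ℕ.+-comm 0 f) ⟩
    + S
      ≡⟨ cancel (+ S) (+ D) (+ M) ⟨
    (+ S - + D + (+ D + + M)) - + M
      ≡⟨ cong (λ x → (+ S - + D + x) - + M) (ℤ.pos-+ D M) ⟨
    (+ S - + D + + (D ℕ.+ M)) - + M
      ≡⟨ ≡.cong₂ (λ x y → (x + + y) - + M) (sumP-zipWith-⊝ vs ds) (≡.sym D+M≡n*des) ⟨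
    (sumP (lamOf 0 (0 , 0) s) + + (n * des (π f))) - + M
      ≡⟨ cong (λ l → (sumP l + + (n * des (π f))) - + M) (lam≡lamOf f) ⟨
    (sumP (lam f) + + (n * des (π f))) - + M ∎
    where
    open ≡.≡-Reasoning
    s = sortedKeys f
    vs = Vec.map proj₁ s
    ds = descentCounts 0 (0 , 0) (π f)
    S = Vec.sum vs
    D = Vec.sum ds
    M = maj (π f)
    cancel : ∀ a b c → (a - b + (b + c)) - c ≡ a
    cancel = ℤ-Solver.solve-∀
    D+M≡n*des : D ℕ.+ M ≡ n * des (π f)
    D+M≡n*des = ≡.trans (sum-descentCounts 0 (0 , 0) 0 (π f))
                        (≡.cong₂ (λ x y → x ℕ.+ y * des (π f)) (ℕ.*-zeroʳ n) (ℕ.+-identityʳ n))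

  π-lam-injective : ∀ {f g : CTuple r n} → π f ≡ π g → lam f ≡ lam g → f ≡ g
  π-lam-injective {f} {g} πf≡πg lamf≡lamg = sortedKeys-injective (map-proj₁-proj₂-injective values≡ πf≡πg)
    where
    open ≡.≡-Reasoning
    values≡ : Vec.map proj₁ (sortedKeys f) ≡ Vec.map proj₁ (sortedKeys g)
    values≡ = zipWith-⊝-cancelʳ _ _ (descentCounts 0 (0 , 0) (π g)) (begin
      Vec.zipWith _⊝_ (Vec.map proj₁ (sortedKeys f)) (descentCounts 0 (0 , 0) (π g))
        ≡⟨ cong (λ w → Vec.zipWith _⊝_ (Vec.map proj₁ (sortedKeys f)) (descentCounts 0 (0 , 0) w)) πf≡πg ⟨
      lamOf 0 (0 , 0) (sortedKeys f) ≡⟨ lam≡lamOf f ⟨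
      lam f                          ≡⟨ lamf≡lamg ⟩
      lam g                          ≡⟨ lam≡lamOf g ⟩
      lamOf 0 (0 , 0) (sortedKeys g) ∎)

  π-lam-surjective : ∀ (w : Window r n) (l : Vec ℤ n) → IsColoredPerm w → InP l →
                     ∃ λ f → InN0 f × π f ≡ w × lam f ≡ l
  π-lam-surjective w l w-perm l∈P with Admissible⇒sortedKeys t t-Distinct t-Admissible
    where
    t : Vec (Key r n) n
    t = unlam 0 (0 , 0) l w
    t-Distinct : Distinct t
    t-Distinct = IsColoredPerm⇒Distinct (≡.subst IsColoredPerm (≡.sym (map-proj₂-unlam 0 (0 , 0) l w)) w-perm)
    t-Admissible : Admissible t
    t-Admissible = unlam-Linked-Ascent 0 (0 , 0) w (InP⇒Linked l∈P)
  ... | f , f∈N0 , sortedKeys≡t = f , f∈N0 ,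
    ≡.trans (cong (Vec.map proj₂) sortedKeys≡t) (map-proj₂-unlam 0 (0 , 0) l w) ,
    ≡.trans (lam≡lamOf f) (≡.trans (cong (lamOf 0 (0 , 0)) sortedKeys≡t)
                                   (lamOf-unlam 0 (0 , 0) l w (AllP.lookup⁻ (proj₁ l∈P))))

proposition3p8 : {r n : ℕ} →
    ((f : CTuple r n) → InN0 f → IsColoredPerm (π f) × InP (lam f))
    × ((f g : CTuple r n) → InN0 f → InN0 g →
    π f ≡ π g → lam f ≡ lam g → f ≡ g)
    × ((w : Window r n) (l : Vec ℤ n) → IsColoredPerm w → InP l →
    ∃ λ f → InN0 f × π f ≡ w × lam f ≡ l)
    × ((f : CTuple r n) → InN0 f → + maxF f ≡ maxP (lam f) + + des (π f))
    × ((f : CTuple r n) → InN0 f →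
    + sumF f ≡ (sumP (lam f) + + (n * des (π f))) - + maj (π f))
proposition3p8 =
    (λ f f∈N0 → Distinct⇒IsColoredPerm (isort-AllPairs ≡.≢-sym (keys-Distinct f)) , lam-InP {f = f} f∈N0)
  , (λ f g _ _ → π-lam-injective)
  , π-lam-surjective
  , (λ f _ → maxF≡maxP+des f)
  , (λ f _ → sumF≡sumP+n*des-maj f)
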